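{- Let $\mathcal{A}=(Q,\delta,I,\Gamma,p,\mathit{Acc})$ be an $\mathrm{Inf}$-TELA with $n=|Q|$, $w\in\Sigma^\omega$, and $G_w$ the run DAG of $\mathcal{A}$ over $w$. Every execution of the labelling algorithm (described in the context) on $G_w$ terminates, and at termination its counter satisfies $i\le 2n$.
   Context: TELA: $\mathcal{A}=(Q,\delta,I,\Gamma,p,\mathit{Acc})$ with finite states $Q$, $\delta\subseteq Q\times\Sigma\times Q$, initial states $I$, colours $\Gamma$, colouring $p:\delta\to2^\Gamma$, $\mathit{Acc}$ a $\wedge/\vee$-formula over $\mathit{true},\mathit{false},\mathrm{Inf}(c),\mathrm{Fin}(c)$. $\mathrm{Inf}$-TELA: no $\mathrm{Fin}$ atoms. $\overline{\mathit{Acc}}$: negation of $\mathit{Acc}$ in negation normal form with $\neg\mathrm{Inf}(c)$ written as variable $c$; $\mathrm{Min}$: the (assumed nonempty) set of $\subseteq$-minimal $M\subseteq\Gamma$ satisfying $\overline{\mathit{Acc}}$; $\mathrm{lex}$: its lexicographically smallest element. Run DAG $G_w=(V,E)$: $(q,i)\in V$ iff some run of $\mathcal{A}$ over $w$ from $I$ has $q$ at position $i$; $((q,i),(q',i'))\in E$ iff $i'=i+1$ and $(q,w_i,q')\in\delta$. For a DAG $G$ and vertex $v$, $\mathrm{reach}_G(v)$ is the set of vertices reachable from $v$ (including $v$); $v$ is finite if $\mathrm{reach}_G(v)$ is finite. An edge $((q,i),(q',i+1))$ is a $c$-edge if $c\in p((q,w_i,q'))$; $v$ is $c$-endangered in $G$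 if it reaches no $c$-edge in $G$, and $C$-endangered if $c$-endangered for all $c\in C$. $v_1,v_2$ converge if $\mathrm{reach}(v_1)\cap\mathrm{reach}(v_2)\ne\emptyset$. For $U\subseteq V$, $\eta:U\to\mathrm{Min}$ is endangered in $G$ if $\eta$ is finite and nonempty, each $v\in U$ is $\eta(v)$-endangered in $G$, and $\eta(v_1)=\eta(v_2)$ for all converging $v_1,v_2\in U$. Labelling algorithm (nondeterministic) on $G_w$: set $i:=0$, $r,m$ empty partial maps. Assign $r(v)=0$, $m(v)=\mathrm{lex}$ to every finite vertex $v$ of $G_w$, and let $G^0$ be $G_w$ without its finite vertices. While $G^i$ is nonempty: if there exist $U\subseteq V(G^i)$ and $\eta:U\to\mathrm{Min}$ endangered in $G^i$ (chosen nondeterministically), then for each $v\in U$ and $u\in\mathrm{reach}_{G^i}(v)$ set $r(u)=i+1$, $m(u)=\eta(v)$; let $G^{i+1}$ be $G^i$ without vertices of rank $i+1$; for each vertex $v$ finite in $G^{i+1}$ set $r(v)=i+2$, $m(v)=\mathrm{lex}$; let $G^{i+2}$ be $G^{i+1}$ without vertices of rank $i+2$; set $i:=i+2$. Otherwise return $\bot$. When the loop exits (because $G^i$ is empty), return $(r,m)$. -}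

module Defs where

open import Data.Nat using (ℕ; zero; suc)
open import Data.Fin using (Fin)
open import Data.Fin.Subset using (Subset; _∈_; _⊆_)
open import Data.Product using (Σ; ∃; ∃-syntax; _×_; _,_)
open import Data.Sum using (_⊎_)
open import Data.Empty using (⊥)
open import Data.Unit using (⊤)
open import Data.List using (List; [])
open import Relation.Nullary using (¬_)
open import Relation.Binary.PropositionalEquality using (_≡_; _≢_)
import Data.List.Membership.Propositional as LM

-- Acceptance conditions of Inf-TELAs: positive Boolean formulas over
-- true, false and Inf(c).  (No Fin atoms: that is what "Inf-TELA" means.)

data InfFormula (nc : ℕ) : Set where
  tt ff : InfFormula nc
  Inf   : Fin nc → InfFormula nc
  _∧_ _∨_ : InfFormula nc → InfFormula nc → InfFormula nc

-- M ⊨ \overline{Acc}: the negation of Acc in negation normal form, where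
-- ¬Inf(c) is the variable c (true iff c ∈ M).
SatNeg : ∀ {nc} → InfFormula nc → Subset nc → Set
SatNeg tt      M = ⊥
SatNeg ff      M = ⊤
SatNeg (Inf c) M = c ∈ M
SatNeg (φ ∧ ψ) M = SatNeg φ M ⊎ SatNeg ψ M
SatNeg (φ ∨ ψ) M = SatNeg φ M × SatNeg ψ M

IsMin : ∀ {nc} → InfFormula nc → Subset nc → Set
IsMin φ M = SatNeg φ M × (∀ M′ → M′ ⊆ M → SatNeg φ M′ → M′ ≡ M)

record InfTELA (Alph : Set) : Set₁ where
  field
    n   : ℕ
    nc  : ℕ
    δ   : Fin n → Alph → Fin n → Set
    I   : Fin n → Set
    p   : Fin n → Alph → Fin n → Subset nc
    Acc : InfFormula nc

module RunDAG {Alph : Set} (A : InfTELA Alph) (w : ℕ → Alph) where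
  open InfTELA A public

  Vtx : Set
  Vtx = Fin n × ℕ          -- (q , i) : state q at position i

  VSet : Set₁
  VSet = Vtx → Set         -- a (sub)graph, given by its vertex set

  data RunTo : Fin n → ℕ → Set where
    start : ∀ {q} → I q → RunTo q zero
    next  : ∀ {q q′ i} → RunTo q i → δ q (w i) q′ → RunTo q′ (suc i)

  Gw : VSet
  Gw (q , i) = RunTo q i

  Edge : Vtx → Vtx → Set
  Edge (q , i) (q′ , i′) = (i′ ≡ suc i) × δ q (w i) q′

  CEdge : Fin nc → Vtx → Vtx → Set
  CEdge c (q , i) (q′ , i′) = Edge (q , i) (q′ , i′) × c ∈ p q (w i) q′

  data Reach (G : VSet) : Vtx → Vtx → Set where
    here : ∀ {v} → G v → Reach G v v
    step : ∀ {u v v′} → Reach G u v → Edge v v′ → G v′ → Reach G u v′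

  open LM using () renaming (_∈_ to _∈ₗ_)

  Finite : (Vtx → Set) → Set
  Finite P = ∃[ L ] (∀ u → P u → u ∈ₗ L)

  FiniteIn : VSet → Vtx → Set
  FiniteIn G v = Finite (Reach G v)

  dropFinite : VSet → VSet
  dropFinite G v = G v × ¬ FiniteIn G v

  CEndangered : VSet → Fin nc → Vtx → Set
  CEndangered G c v = ¬ (∃[ u ] ∃[ u′ ] (Reach G v u × G u′ × CEdge c u u′))

  SetEndangered : VSet → Subset nc → Vtx → Set
  SetEndangered G C v = ∀ c → c ∈ C → CEndangered G c v

  Converge : VSet → Vtx → Vtx → Set
  Converge G v₁ v₂ = ∃[ u ] (Reach G v₁ u × Reach G v₂ u)

  Endangered : VSet → List Vtx → (Vtx → Subset nc) → Set
  Endangered G U η =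
      (U ≢ [])
    × (∀ v → v ∈ₗ U → G v)
    × (∀ v → v ∈ₗ U → IsMin Acc (η v))
    × (∀ v → v ∈ₗ U → SetEndangered G (η v) v)
    × (∀ v₁ v₂ → v₁ ∈ₗ U → v₂ ∈ₗ U → Converge G v₁ v₂ → η v₁ ≡ η v₂)

  -- G without the vertices reachable (in G) from U  (rank i+1 vertices)
  dropReach : VSet → List Vtx → VSet
  dropReach G U v = G v × ¬ (∃[ u ] (u ∈ₗ U × Reach G u v))

  -- one loop iteration: G^i ↦ G^{i+2}
  iter : VSet → List Vtx → VSet
  iter G U = dropFinite (dropReach G U)

  G0 : VSet
  G0 = dropFinite Gw

  -- Exec G k : a (prefix of an) execution of the loop starting from graph G
  -- performing k complete iterations (each increasing the counter by 2);
  -- each iteration is entered only with nonempty G and uses a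
  -- nondeterministically chosen endangered η : U → Min.
  data Exec : VSet → ℕ → Set₁ where
    stop : ∀ {G} → Exec G zero
    loop : ∀ {G k} (U : List Vtx) (η : Vtx → Subset nc) →
           (∃[ v ] G v) → Endangered G U η →
           Exec (iter G U) k → Exec G (suc k)

MinNonempty : ∀ {Alph} → InfTELA Alph → Set
MinNonempty A = ∃[ M ] IsMin (InfTELA.Acc A) M

-- Each loop iteration chooses a nonempty U of vertices of the current graph; such a
-- vertex v is not finite, so it has a descendant at every later position j, and that
-- descendant is deleted along with everything v reaches. So from some position on,
-- every iteration deletes one more state at each position, which can happen at most
-- n = |Q| times.
module Submission where

open import Defs
open import Data.Nat using (ℕ; zero; suc; _*_; _+_; _⊔_; _≤_; _<_; _≟_; _<?_; _≤?_)
open import Data.Nat.Properties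
  using (≤-refl; ≤-trans; ≤-antisym; ≤-pred; ≤∧≢⇒<; ≮⇒≥; m≤m⊔n; m≤n⊔m; +-suc; +-identityʳ; *-monoʳ-≤)
open import Data.Fin as Fin using (Fin)
open import Data.Fin.Properties using (injective⇒≤)
import Data.Vec.Functional as Vector
open import Data.Product using (Σ; ∃-syntax; _×_; _,_; proj₁; proj₂)
open import Data.Empty using (⊥-elim)
open import Data.List using (List; []; _∷_; _++_; map; allFin)
open import Data.List.Membership.Propositional using () renaming (_∈_ to _∈ₗ_)
open import Data.List.Membership.Propositional.Properties using (∈-map⁺; ∈-++⁺ˡ; ∈-++⁺ʳ; ∈-allFin)
open import Data.List.Relation.Unary.Any using (here)
open import Function using (_∘_)
open import Function.Definitions using (Injective)
open import Relation.Nullary using (¬_; yes; no)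
open import Relation.Nullary.Decidable using (decidable-stable)
open import Relation.Binary.PropositionalEquality using (_≡_; _≢_; refl; sym; cong; subst)

module _ {Alph : Set} (A : InfTELA Alph) (w : ℕ → Alph) where
  open RunDAG A w

  Reach-target : ∀ {G u v} → Reach G u v → G v
  Reach-target (here Gv)     = Gv
  Reach-target (step _ _ Gv) = Gv

  Reach-trans : ∀ {G u v x} → Reach G u v → Reach G v x → Reach G u x
  Reach-trans r (here _)        = r
  Reach-trans r (step r′ e Gx) = step (Reach-trans r r′) e Gx

  Reach-through-level : ∀ {G v q′ j′} j → Reach G v (q′ , j′) →
                        proj₂ v ≤ j → j ≤ j′ → ∃[ q ] Reach G v (q , j)
  Reach-through-level {q′ = q′} j (here Gv) v≤j j≤j′
    rewrite ≤-antisym j≤j′ v≤j = q′ , here Gv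
  Reach-through-level {q′ = q′} j (step {v = _ , i} r (refl , d) Gv) v≤j j≤j′ with j ≟ suc i
  ... | yes refl = q′ , step r (refl , d) Gv
  ... | no j≢1+i = Reach-through-level j r v≤j (≤-pred (≤∧≢⇒< j≤j′ j≢1+i))

  FiniteIn-Reach : ∀ {G u v} → Reach G u v → FiniteIn G u → FiniteIn G v
  FiniteIn-Reach r (L , cover) = L , λ x v⇝x → cover x (Reach-trans r v⇝x)

  below : ℕ → List Vtx
  below zero    = []
  below (suc j) = map (_, j) (allFin n) ++ below j

  ∈-below : ∀ q {i} j → i < j → (q , i) ∈ₗ below j
  ∈-below q {i} (suc j) i<1+j with i ≟ j
  ... | yes refl = ∈-++⁺ˡ (∈-map⁺ (_, j) (∈-allFin q))
  ... | no i≢j   = ∈-++⁺ʳ (map (_, j) (allFin n)) (∈-below q j (≤∧≢⇒< (≤-pred i<1+j) i≢j))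

  -- If v reached nothing at position j, everything it reaches would lie in `below j`.
  ¬FiniteIn⇒reaches-level : ∀ {G v} j → ¬ FiniteIn G v → proj₂ v ≤ j →
                            ¬ ¬ (∃[ q ] Reach G v (q , j))
  ¬FiniteIn⇒reaches-level {G} {v} j infinite v≤j unreached = infinite (below j , cover)
    where
    cover : ∀ u → Reach G v u → u ∈ₗ below j
    cover (q′ , j′) r with j′ <? j
    ... | yes j′<j = ∈-below q′ j j′<j
    ... | no j′≮j  = ⊥-elim (unreached (Reach-through-level j r v≤j (≮⇒≥ j′≮j)))

  Reach-dropFinite : ∀ {G u v} → Reach G u v → ¬ FiniteIn G v → Reach (dropFinite G) u v
  Reach-dropFinite (here Gv) infinite = here (Gv , infinite)
  Reach-dropFinite (step r e Gv) infinite =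
    step (Reach-dropFinite r (infinite ∘ FiniteIn-Reach (step (here (Reach-target r)) e Gv)))
         e (Gv , infinite)

  Missing : VSet → ℕ → ℕ → Set
  Missing G t j = Σ (Fin t → Fin n) λ f → Injective _≡_ _≡_ f × (∀ a → ¬ G (f a , j))

  Missing⇒≤ : ∀ {G t j} → Missing G t j → t ≤ n
  Missing⇒≤ (f , f-injective , _) = injective⇒≤ f-injective

  Missing-extend : ∀ {G G′ t j q} → (∀ {u} → G′ u → G u) → G (q , j) → ¬ G′ (q , j) →
                   Missing G t j → Missing G′ (suc t) j
  Missing-extend {G} {G′} {t} {j} {q} G′⊆G Gq ¬G′q (f , f-injective , f-missing) =
    q Vector.∷ f , injective , missing
    where
    q∉f : ∀ a → q ≢ f a
    q∉f a q≡fa = f-missing a (subst (λ x → G (x , j)) q≡fa Gq)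
    injective : Injective _≡_ _≡_ (q Vector.∷ f)
    injective {Fin.zero}  {Fin.zero}  _   = refl
    injective {Fin.zero}  {Fin.suc b} eq  = ⊥-elim (q∉f b eq)
    injective {Fin.suc a} {Fin.zero}  eq  = ⊥-elim (q∉f a (sym eq))
    injective {Fin.suc a} {Fin.suc b} eq  = cong Fin.suc (f-injective eq)
    missing : ∀ a → ¬ G′ ((q Vector.∷ f) a , j)
    missing Fin.zero    = ¬G′q
    missing (Fin.suc a) = f-missing a ∘ G′⊆G

  EventuallyMissing : VSet → ℕ → Set
  EventuallyMissing G t = ∃[ L ] (∀ j → L ≤ j → ¬ ¬ Missing G t j)

  EventuallyMissing-zero : ∀ {G} → EventuallyMissing G 0
  EventuallyMissing-zero = 0 , λ _ _ ¬missing → ¬missing ((λ ()) , (λ { {()} }) , (λ ()))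

  EventuallyMissing⇒≤ : ∀ {G t} → EventuallyMissing G t → t ≤ n
  EventuallyMissing⇒≤ {G} {t} (L , missing) =
    decidable-stable (t ≤? n) (λ t≰n → missing L ≤-refl (t≰n ∘ Missing⇒≤ {G}))

  -- The descendant (q , j) of v is not in the next graph: there it would be infinite in
  -- G, so v would reach it inside dropFinite G and it would have been deleted.
  EventuallyMissing-iteration : ∀ {G t U v} → v ∈ₗ U → dropFinite G v →
                                EventuallyMissing G t →
                                EventuallyMissing (dropReach (dropFinite G) U) (suc t)
  EventuallyMissing-iteration {G} {t} {U} {v} v∈U (_ , v-infinite) (L , missing) =
    L ⊔ proj₂ v , λ j L⊔v≤j ¬missing′ →
      ¬FiniteIn⇒reaches-level j v-infinite (≤-trans (m≤n⊔m L (proj₂ v)) L⊔v≤j) λ (q , v⇝q) →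
        missing j (≤-trans (m≤m⊔n L (proj₂ v)) L⊔v≤j) λ missing-j →
          ¬missing′ (Missing-extend {G} {dropReach (dropFinite G) U}
                       (proj₁ ∘ proj₁) (Reach-target v⇝q) (removed v⇝q) missing-j)
    where
    removed : ∀ {x} → Reach G v x → ¬ dropReach (dropFinite G) U x
    removed v⇝x ((_ , x-infinite) , unreached) =
      unreached (v , v∈U , Reach-dropFinite v⇝x x-infinite)

  Endangered-witness : ∀ {G U η} → Endangered G U η → ∃[ v ] (v ∈ₗ U × G v)
  Endangered-witness {U = []}    (U≢[] , _) = ⊥-elim (U≢[] refl)
  Endangered-witness {U = v ∷ _} (_ , U⊆G , _) = v , here refl , U⊆G v (here refl)

  Exec-bound : ∀ {G t k} → Exec (dropFinite G) k → EventuallyMissing G t → t + k ≤ n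
  Exec-bound {G} {t} stop missing =
    subst (_≤ n) (sym (+-identityʳ t)) (EventuallyMissing⇒≤ {G} missing)
  Exec-bound {G} {t} {suc k} (loop U η _ endangered rest) missing
    with v , v∈U , Gv ← Endangered-witness endangered =
    subst (_≤ n) (sym (+-suc t k))
          (Exec-bound {dropReach (dropFinite G) U} rest
                      (EventuallyMissing-iteration v∈U Gv missing))

lemma2 : ∀ {Alph : Set} (A : InfTELA Alph) (w : ℕ → Alph) → MinNonempty A →
    ∀ k → RunDAG.Exec A w (RunDAG.G0 A w) k → 2 * k ≤ 2 * InfTELA.n A
lemma2 A w _ k exec = *-monoʳ-≤ 2 (Exec-bound A w exec (EventuallyMissing-zero A w {RunDAG.Gw A w}))
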